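{- For each partial order $Q_n$ on $[n]$, \[ e(Q_n) \geq n! \, 2^{ -\mathrm{comp}(Q_n)}.\]
   Context: For a finite poset $Q_n$ on $n$ points, $e(Q_n)$ denotes its number of linear extensions and $\mathrm{comp}(Q_n)$ denotes the number of edges in its comparability graph (the number of comparable pairs). -}

module Defs where

open import Data.Bool using (Bool; true; false; _∨_; T)
open import Data.Nat using (ℕ; zero; suc)
open import Data.Fin using (Fin; _<_; _≤_; _≟_; _<?_; _≤?_)
open import Data.Fin.Properties using (all?)
open import Data.List using (List; []; _∷_; concatMap; map; filter; length; allFin)
open import Data.Vec using (Vec; []; _∷_; lookup)
open import Data.Product using (_×_)
open import Relation.Nullary using (Dec; ¬_; yes; no)
open import Relation.Nullary.Decidable using (_→-dec_; _×-dec_; ¬?)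
open import Relation.Binary.PropositionalEquality using (_≡_)

Rel : ℕ → Set
Rel n = Fin n → Fin n → Bool

allVecs : (n k : ℕ) → List (Vec (Fin n) k)
allVecs n zero = [] ∷ []
allVecs n (suc k) = concatMap (λ i → map (i ∷_) (allVecs n k)) (allFin n)

-- A linear extension of R is encoded as the position map
-- σ : [n] → [n] (σ i = position of i in the linear order), which must be
-- a bijection (injective suffices, [n] being finite) and must satisfy
-- i ≼ j ⇒ σ i ≤ σ j.
IsLinExt : {n : ℕ} → Rel n → Vec (Fin n) n → Set
IsLinExt {n} R σ =
  ((i j : Fin n) → lookup σ i ≡ lookup σ j → i ≡ j) ×
  ((i j : Fin n) → T (R i j) → lookup σ i ≤ lookup σ j)

isLinExt? : {n : ℕ} → (R : Rel n) → (σ : Vec (Fin n) n) → Dec (IsLinExt R σ)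
isLinExt? {n} R σ =
  all? (λ i → all? (λ j → (lookup σ i ≟ lookup σ j) →-dec (i ≟ j)))
  ×-dec
  all? (λ i → all? (λ j → T? (R i j) →-dec (lookup σ i ≤? lookup σ j)))
  where
  T? : (b : Bool) → Dec (T b)
  T? true = yes _
  T? false = no (λ ())

linExtCount : {n : ℕ} → Rel n → ℕ
linExtCount {n} R = length (filter (isLinExt? R) (allVecs n n))

Comparable : {n : ℕ} → Rel n → Fin n → Fin n → Set
Comparable R i j = i < j × T (R i j ∨ R j i)

comparable? : {n : ℕ} → (R : Rel n) → (i j : Fin n) → Dec (Comparable R i j)
comparable? R i j = (i <? j) ×-dec T? (R i j ∨ R j i)
  where
  T? : (b : Bool) → Dec (T b)
  T? true = yes _
  T? false = no (λ ())

allPairs : (n : ℕ) → List (Fin n × Fin n)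
allPairs n = concatMap (λ i → map (λ j → i Data.Product., j) (allFin n)) (allFin n)

compCount : {n : ℕ} → Rel n → ℕ
compCount {n} R = length (filter (λ p → comparable? R (Data.Product.proj₁ p) (Data.Product.proj₂ p)) (allPairs n))

-- Induction on n, deleting a minimal element x. Let d(x) be the number of
-- elements comparable to x. Every element lies above some minimal element and
-- the up-set of x has at most 1 + d(x) ≤ 2^d(x) elements, so
-- n ≤ Σ_{x minimal} 2^d(x). Deleting x removes d(x) comparable pairs, and
-- putting x in front of a linear extension of Q ∖ x gives a linear extension
-- of Q starting with x; these are distinct for distinct pairs (x, extension).
-- Hence
--   n! ≤ Σ_x 2^d(x) (n-1)! ≤ Σ_x 2^d(x) e(Q ∖ x) 2^comp(Q ∖ x)
--      ≤ 2^comp(Q) Σ_x e(Q ∖ x) ≤ 2^comp(Q) e(Q).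
module Submission where

open import Defs
open import Data.Bool using (T)
open import Data.Bool.Properties using (T-∨)
open import Data.Fin as Fin using (Fin; zero; suc; punchIn; punchOut; _≟_)
open import Data.Fin.Properties as Finₚ
  using (all?; any?; <-cmp; 0≢1+n; punchInᵢ≢i; punchIn-injective; punchIn-punchOut;
         punchIn-mono-≤; punchIn-cancel-≤)
open import Data.List
  using (List; []; _∷_; filter; length; map; tabulate; concatMap; allFin; _++_; cartesianProductWith)
open import Data.List.Properties using (length-map; length-++-sucʳ; map-tabulate; filter-++; length-++)
open import Data.List.Membership.Propositional using (_∈_)
open import Data.List.Membership.Propositional.Properties
  using (∈-∃++; ∈-++⁻; ∈-++⁺ˡ; ∈-++⁺ʳ; ∈-map⁻; ∈-filter⁺; ∈-filter⁻; ∈-allFin;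
         ∈-cartesianProductWith⁺)
open import Data.List.Relation.Binary.Subset.Propositional using (_⊆_)
open import Data.List.Relation.Unary.Any using (here; there)
import Data.List.Relation.Unary.All as All
open import Data.List.Relation.Unary.AllPairs as AllPairs using (_∷_)
open import Data.List.Relation.Unary.Unique.Propositional using (Unique)
import Data.List.Relation.Unary.Unique.Propositional.Properties as Uniqueₚ
open import Data.Nat using (ℕ; zero; suc; _+_; _*_; _^_; _≤_; _<_; z≤n; s≤s)
open import Data.Nat.Base using (_!)
open import Data.Nat.Induction using (<-wellFounded)
open import Data.Nat.Properties hiding (_≟_; <-cmp; 0≢1+n)
open import Data.Nat.Solver using (module +-*-Solver)
open import Data.Product using (_×_; _,_; proj₁; proj₂; ∃-syntax)
open import Data.Sum using (inj₁; inj₂)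
open import Data.Vec as Vec using (Vec; lookup; insertAt)
import Data.Vec.Properties as Vecₚ
open import Function using (_∘_; Injective; Equivalence)
open import Induction.WellFounded using (Acc; acc)
open import Level using (Level)
open import Relation.Binary.Definitions using (tri<; tri≈; tri>)
open import Relation.Binary.PropositionalEquality
open import Relation.Binary.Structures using (IsPartialOrder)
open import Relation.Nullary using (Dec; yes; no; ¬_; contradiction)
open import Relation.Nullary.Decidable using (T?; _×-dec_; _→-dec_; ¬?)
open import Relation.Unary using (Pred; Decidable)

open import Algebra.Properties.Semiring.Sum +-*-semiring
  using (sum; sum-cong-≗; sum-remove; sum-replicate-zero; ∑-distrib-+; ∑-comm;
         *-distribˡ-sum; *-distribʳ-sum)

private
  variable
    a p q : Level
    A : Set a
    n : ℕ

𝟙 : {P : Set p} → Dec P → ℕ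
𝟙 (yes _) = 1
𝟙 (no _)  = 0

module _ {P : Set p} where

  𝟙-yes : (P? : Dec P) → P → 𝟙 P? ≡ 1
  𝟙-yes (yes _) _ = refl
  𝟙-yes (no ¬p) p = contradiction p ¬p

  𝟙-no : (P? : Dec P) → ¬ P → 𝟙 P? ≡ 0
  𝟙-no (yes p) ¬p = contradiction p ¬p
  𝟙-no (no _)  _  = refl

  𝟙≤1 : (P? : Dec P) → 𝟙 P? ≤ 1
  𝟙≤1 (yes _) = s≤s z≤n
  𝟙≤1 (no _)  = z≤n

𝟙-mono : {P : Set p} {Q : Set q} (P? : Dec P) (Q? : Dec Q) → (P → Q) → 𝟙 P? ≤ 𝟙 Q?
𝟙-mono (yes _) (yes _) _   = ≤-refl
𝟙-mono (yes p) (no ¬q) P⇒Q = contradiction (P⇒Q p) ¬q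
𝟙-mono (no _)  _       _   = z≤n

𝟙-cong : {P : Set p} {Q : Set q} (P? : Dec P) (Q? : Dec Q) → (P → Q) → (Q → P) → 𝟙 P? ≡ 𝟙 Q?
𝟙-cong P? Q? P⇒Q Q⇒P = ≤-antisym (𝟙-mono P? Q? P⇒Q) (𝟙-mono Q? P? Q⇒P)

sum-const-1 : ∀ n → sum {n} (λ _ → 1) ≡ n
sum-const-1 zero    = refl
sum-const-1 (suc n) = cong suc (sum-const-1 n)

sum-zero : {f : Fin n → ℕ} → (∀ i → f i ≡ 0) → sum f ≡ 0
sum-zero {n} f≡0 = trans (sum-cong-≗ f≡0) (sum-replicate-zero n)

sum-mono-≤ : {f g : Fin n → ℕ} → (∀ i → f i ≤ g i) → sum f ≤ sum g
sum-mono-≤ {zero}  f≤g = z≤n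
sum-mono-≤ {suc n} f≤g = +-mono-≤ (f≤g zero) (sum-mono-≤ (f≤g ∘ suc))

sum-mono-< : {f g : Fin n → ℕ} (x : Fin n) → (∀ i → f i ≤ g i) → f x < g x → sum f < sum g
sum-mono-< {suc n} {f} {g} x f≤g fx<gx = begin-strict
  sum f                           ≡⟨ sum-remove {i = x} f ⟩
  f x + sum (f ∘ punchIn x)       <⟨ +-mono-<-≤ fx<gx (sum-mono-≤ (f≤g ∘ punchIn x)) ⟩
  g x + sum (g ∘ punchIn x)       ≡⟨ sum-remove {i = x} g ⟨
  sum g                           ∎
  where open ≤-Reasoning

term≤sum : (x : Fin n) (f : Fin n → ℕ) → f x ≤ sum f
term≤sum {suc n} x f = ≤-trans (m≤m+n (f x) _) (≤-reflexive (sym (sum-remove {i = x} f)))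

sum-𝟙≤𝟙 : {P : Fin n → Set p} {Q : Set q} (P? : ∀ i → Dec (P i)) (Q? : Dec Q) →
          (∀ i → P i → Q) → (∀ {i j} → P i → P j → i ≡ j) →
          sum (λ i → 𝟙 (P? i)) ≤ 𝟙 Q?
sum-𝟙≤𝟙 {zero}  P? Q? P⇒Q exclusive = z≤n
sum-𝟙≤𝟙 {suc n} {P = P} P? Q? P⇒Q exclusive = split (P? zero)
  where
  split : (P₀? : Dec (P zero)) → 𝟙 P₀? + sum (λ i → 𝟙 (P? (suc i))) ≤ 𝟙 Q?
  split (yes p₀) = ≤-reflexive (begin
    1 + sum (λ i → 𝟙 (P? (suc i)))
      ≡⟨ cong suc (sum-zero (λ i → 𝟙-no (P? (suc i)) (0≢1+n ∘ exclusive p₀))) ⟩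
    1
      ≡⟨ 𝟙-yes Q? (P⇒Q zero p₀) ⟨
    𝟙 Q?
      ∎)
    where open ≡-Reasoning
  split (no _) =
    sum-𝟙≤𝟙 (P? ∘ suc) Q? (P⇒Q ∘ suc) (λ pᵢ pⱼ → Finₚ.suc-injective (exclusive pᵢ pⱼ))

count : {P : Pred A p} → Decidable P → List A → ℕ
count P? xs = length (filter P? xs)

module _ {P : Pred A p} (P? : Decidable P) where

  count-∷ : ∀ x xs → count P? (x ∷ xs) ≡ 𝟙 (P? x) + count P? xs
  count-∷ x xs with P? x
  ... | yes _ = refl
  ... | no _  = refl

  count-tabulate : (f : Fin n → A) → count P? (tabulate f) ≡ sum (λ i → 𝟙 (P? (f i)))
  count-tabulate {n = zero}  f = refl
  count-tabulate {n = suc n} f =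
    trans (count-∷ (f zero) _) (cong (𝟙 (P? (f zero)) +_) (count-tabulate (f ∘ suc)))

  count-concatMap-tabulate : {B : Set a} (g : B → List A) (f : Fin n → B) →
                             count P? (concatMap g (tabulate f)) ≡ sum (λ i → count P? (g (f i)))
  count-concatMap-tabulate {n = zero}  g f = refl
  count-concatMap-tabulate {n = suc n} g f = begin
    length (filter P? (g (f zero) ++ concatMap g (tabulate (f ∘ suc))))
      ≡⟨ cong length (filter-++ P? (g (f zero)) _) ⟩
    length (filter P? (g (f zero)) ++ filter P? (concatMap g (tabulate (f ∘ suc))))
      ≡⟨ length-++ (filter P? (g (f zero))) ⟩
    count P? (g (f zero)) + count P? (concatMap g (tabulate (f ∘ suc)))
      ≡⟨ cong (count P? (g (f zero)) +_) (count-concatMap-tabulate g (f ∘ suc)) ⟩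
    sum (λ i → count P? (g (f i))) ∎
    where open ≡-Reasoning

sum-count≤count : {P : Fin n → Pred A p} {Q : Pred A q}
                  (P? : ∀ i → Decidable (P i)) (Q? : Decidable Q) →
                  (∀ i {v} → P i v → Q v) → (∀ {i j v} → P i v → P j v → i ≡ j) →
                  ∀ xs → sum (λ i → count (P? i) xs) ≤ count Q? xs
sum-count≤count {n = n} P? Q? P⇒Q exclusive [] = ≤-reflexive (sum-replicate-zero n)
sum-count≤count P? Q? P⇒Q exclusive (v ∷ xs) = begin
  sum (λ i → count (P? i) (v ∷ xs))
    ≡⟨ sum-cong-≗ (λ i → count-∷ (P? i) v xs) ⟩
  sum (λ i → 𝟙 (P? i v) + count (P? i) xs)
    ≡⟨ ∑-distrib-+ (λ i → 𝟙 (P? i v)) _ ⟩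
  sum (λ i → 𝟙 (P? i v)) + sum (λ i → count (P? i) xs)
    ≤⟨ +-mono-≤ (sum-𝟙≤𝟙 (λ i → P? i v) (Q? v) (λ i → P⇒Q i) exclusive)
                (sum-count≤count P? Q? P⇒Q exclusive xs) ⟩
  𝟙 (Q? v) + count Q? xs
    ≡⟨ count-∷ Q? v xs ⟨
  count Q? (v ∷ xs)
    ∎
  where open ≤-Reasoning

Unique-⊆⇒length≤ : {xs ys : List A} → Unique xs → xs ⊆ ys → length xs ≤ length ys
Unique-⊆⇒length≤ {xs = []}     _                 _       = z≤n
Unique-⊆⇒length≤ {xs = x ∷ xs} (x∉xs ∷ xs-unique) x∷xs⊆ys
  with us , vs , refl ← ∈-∃++ (x∷xs⊆ys (here refl)) = begin
    suc (length xs)          ≤⟨ s≤s (Unique-⊆⇒length≤ xs-unique xs⊆us++vs) ⟩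
    suc (length (us ++ vs))  ≡⟨ length-++-sucʳ us x vs ⟨
    length (us ++ x ∷ vs)    ∎
  where
  open ≤-Reasoning
  xs⊆us++vs : xs ⊆ us ++ vs
  xs⊆us++vs z∈xs with ∈-++⁻ us (x∷xs⊆ys (there z∈xs))
  ... | inj₁ z∈us          = ∈-++⁺ˡ z∈us
  ... | inj₂ (here refl)   = contradiction refl (All.lookup x∉xs z∈xs)
  ... | inj₂ (there z∈vs)  = ∈-++⁺ʳ us z∈vs

allVecs-suc : ∀ m k → allVecs m (suc k) ≡ cartesianProductWith Vec._∷_ (allFin m) (allVecs m k)
allVecs-suc m k = concatMap-map (allFin m)
  where
  concatMap-map : ∀ is → concatMap (λ i → map (i Vec.∷_) (allVecs m k)) is
                         ≡ cartesianProductWith Vec._∷_ is (allVecs m k)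
  concatMap-map []       = refl
  concatMap-map (i ∷ is) = cong (map (i Vec.∷_) (allVecs m k) ++_) (concatMap-map is)

∈-allVecs : ∀ {m k} (v : Vec (Fin m) k) → v ∈ allVecs m k
∈-allVecs Vec.[]            = here refl
∈-allVecs {m} {suc k} (i Vec.∷ v) =
  subst ((i Vec.∷ v) ∈_) (sym (allVecs-suc m k))
        (∈-cartesianProductWith⁺ Vec._∷_ (∈-allFin i) (∈-allVecs v))

allVecs-unique : ∀ m k → Unique (allVecs m k)
allVecs-unique m zero    = All.[] ∷ AllPairs.[]
allVecs-unique m (suc k) = subst Unique (sym (allVecs-suc m k))
  (Uniqueₚ.cartesianProductWith⁺ Vec._∷_ Vecₚ.∷-injective (Uniqueₚ.allFin⁺ m) (allVecs-unique m k))

count-allVecs-≤ : ∀ {m k m′ k′} {P : Pred (Vec (Fin m) k) p} {Q : Pred (Vec (Fin m′) k′) q}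
                  (P? : Decidable P) (Q? : Decidable Q) (f : Vec (Fin m) k → Vec (Fin m′) k′) →
                  Injective _≡_ _≡_ f → (∀ {v} → P v → Q (f v)) →
                  count P? (allVecs m k) ≤ count Q? (allVecs m′ k′)
count-allVecs-≤ {m = m} {k} {m′} {k′} P? Q? f f-injective f-preserves = begin
  count P? (allVecs m k)                     ≡⟨ length-map f (filter P? (allVecs m k)) ⟨
  length (map f (filter P? (allVecs m k)))   ≤⟨ Unique-⊆⇒length≤ image-unique image⊆ ⟩
  count Q? (allVecs m′ k′)                   ∎
  where
  open ≤-Reasoning
  image-unique : Unique (map f (filter P? (allVecs m k)))
  image-unique = Uniqueₚ.map⁺ f-injective (Uniqueₚ.filter⁺ P? (allVecs-unique m k))
  image⊆ : map f (filter P? (allVecs m k)) ⊆ filter Q? (allVecs m′ k′)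
  image⊆ fv∈ with v , v∈ , refl ← ∈-map⁻ f fv∈ =
    ∈-filter⁺ Q? (∈-allVecs (f v)) (f-preserves (proj₂ (∈-filter⁻ P? {xs = allVecs m k} v∈)))

-- Minimal elements, up-sets and comparable pairs

IsPartialOrderᵇ : Rel n → Set
IsPartialOrderᵇ {n} R = IsPartialOrder (_≡_ {A = Fin n}) (λ i j → T (R i j))

IsMinimal : Rel n → Fin n → Set
IsMinimal R x = ∀ i → T (R i x) → i ≡ x

minimal? : (R : Rel n) (x : Fin n) → Dec (IsMinimal R x)
minimal? R x = all? (λ i → T? (R i x) →-dec (i ≟ x))

downsetSize : Rel n → Fin n → ℕ
downsetSize R j = sum (λ i → 𝟙 (T? (R i j)))

upsetSize : Rel n → Fin n → ℕ
upsetSize R i = sum (λ j → 𝟙 (T? (R i j)))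

module _ {R : Rel n} (po : IsPartialOrderᵇ R) where

  open IsPartialOrder po using (reflexive; antisym) renaming (trans to ≼-trans)

  downsetSize-< : ∀ {i j} → T (R i j) → i ≢ j → downsetSize R i < downsetSize R j
  downsetSize-< {i} {j} i≼j i≢j = sum-mono-< j below-i⇒below-j j⋠i
    where
    below-i⇒below-j : ∀ k → 𝟙 (T? (R k i)) ≤ 𝟙 (T? (R k j))
    below-i⇒below-j k = 𝟙-mono (T? (R k i)) (T? (R k j)) (λ k≼i → ≼-trans k≼i i≼j)
    j⋠i : 𝟙 (T? (R j i)) < 𝟙 (T? (R j j))
    j⋠i = subst₂ _<_ (sym (𝟙-no (T? (R j i)) (i≢j ∘ antisym i≼j)))
                     (sym (𝟙-yes (T? (R j j)) (reflexive refl)))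
                     (s≤s z≤n)

  minimal-below : ∀ j → ∃[ x ] IsMinimal R x × T (R x j)
  minimal-below j = go j (<-wellFounded (downsetSize R j))
    where
    go : ∀ j → Acc _<_ (downsetSize R j) → ∃[ x ] IsMinimal R x × T (R x j)
    go j (acc smaller) with any? (λ i → T? (R i j) ×-dec ¬? (i ≟ j))
    ... | yes (i , i≼j , i≢j) with x , x-minimal , x≼i ← go i (smaller (downsetSize-< i≼j i≢j)) =
      x , x-minimal , ≼-trans x≼i i≼j
    ... | no nothing-below = j , j-minimal , reflexive refl
      where
      j-minimal : IsMinimal R j
      j-minimal i i≼j with i ≟ j
      ... | yes i≡j = i≡j
      ... | no i≢j  = contradiction (i , i≼j , i≢j) nothing-below

_∖_ : Rel (suc n) → Fin (suc n) → Rel n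
(R ∖ x) i j = R (punchIn x i) (punchIn x j)

∖-isPartialOrder : {R : Rel (suc n)} (x : Fin (suc n)) → IsPartialOrderᵇ R → IsPartialOrderᵇ (R ∖ x)
∖-isPartialOrder x po = record
  { isPreorder = record
    { isEquivalence = isEquivalence
    ; reflexive     = λ { refl → reflexive refl }
    ; trans         = ≼-trans
    }
  ; antisym = λ i≼j j≼i → punchIn-injective x _ _ (antisym i≼j j≼i)
  }
  where open IsPartialOrder po using (reflexive; antisym) renaming (trans to ≼-trans)

comp : Rel n → Fin n → Fin n → ℕ
comp R i j = 𝟙 (comparable? R i j)

compCount≡∑∑comp : (R : Rel n) → compCount R ≡ sum (λ i → sum (λ j → comp R i j))
compCount≡∑∑comp {n} R = begin
  compCount R
    ≡⟨ count-concatMap-tabulate P? (λ i → map (i ,_) (allFin n)) (λ i → i) ⟩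
  sum (λ i → count P? (map (i ,_) (allFin n)))
    ≡⟨ sum-cong-≗ (λ i → cong (count P?) (map-tabulate (λ j → j) (i ,_))) ⟩
  sum (λ i → count P? (tabulate (i ,_)))
    ≡⟨ sum-cong-≗ (λ i → count-tabulate P? (i ,_)) ⟩
  sum (λ i → sum (λ j → comp R i j))
    ∎
  where
  open ≡-Reasoning
  P? : Decidable (λ (ij : Fin n × Fin n) → Comparable R (proj₁ ij) (proj₂ ij))
  P? (i , j) = comparable? R i j

punchIn-mono-< : ∀ (x : Fin (suc n)) {i j} → i Fin.< j → punchIn x i Fin.< punchIn x j
punchIn-mono-< x {i} {j} i<j = ≰⇒> (<⇒≱ i<j ∘ punchIn-cancel-≤ x j i)

punchIn-cancel-< : ∀ (x : Fin (suc n)) {i j} → punchIn x i Fin.< punchIn x j → i Fin.< j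
punchIn-cancel-< x {i} {j} i<j = ≰⇒> (<⇒≱ i<j ∘ punchIn-mono-≤ x j i)

comp-∖ : (R : Rel (suc n)) (x : Fin (suc n)) (i j : Fin n) →
         comp (R ∖ x) i j ≡ comp R (punchIn x i) (punchIn x j)
comp-∖ R x i j = 𝟙-cong (comparable? (R ∖ x) i j) (comparable? R _ _)
  (λ (i<j , i~j) → punchIn-mono-< x i<j , i~j) (λ (i<j , i~j) → punchIn-cancel-< x i<j , i~j)

-- comp R i j vanishes unless i < j, hence both orientations.
compDegree : Rel (suc n) → Fin (suc n) → ℕ
compDegree R x = sum (λ j → comp R x (punchIn x j) + comp R (punchIn x j) x)

∑∑-remove : (x : Fin (suc n)) (f : Fin (suc n) → Fin (suc n) → ℕ) →
            sum (λ i → sum (f i)) ≡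
            f x x + (sum (λ j → f x (punchIn x j) + f (punchIn x j) x)
                     + sum (λ i → sum (λ j → f (punchIn x i) (punchIn x j))))
∑∑-remove x f = begin
  sum (λ i → sum (f i))
    ≡⟨ sum-remove {i = x} (λ i → sum (f i)) ⟩
  sum (f x) + sum (λ i → sum (f (punchIn x i)))
    ≡⟨ cong₂ _+_ (sum-remove {i = x} (f x))
                 (sum-cong-≗ (λ i → sum-remove {i = x} (f (punchIn x i)))) ⟩
  (f x x + row) + sum (λ i → f (punchIn x i) x + sum (λ j → f (punchIn x i) (punchIn x j)))
    ≡⟨ cong ((f x x + row) +_) (∑-distrib-+ (λ i → f (punchIn x i) x) _) ⟩
  (f x x + row) + (column + rest)
    ≡⟨ solve 4 (λ w x y z → (w :+ x) :+ (y :+ z) := w :+ ((x :+ y) :+ z)) refl (f x x) row column rest ⟩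
  f x x + ((row + column) + rest)
    ≡⟨ cong (λ s → f x x + (s + rest)) (∑-distrib-+ (λ j → f x (punchIn x j)) (λ j → f (punchIn x j) x)) ⟨
  f x x + (sum (λ j → f x (punchIn x j) + f (punchIn x j) x) + rest) ∎
  where
  open ≡-Reasoning
  open +-*-Solver
  row column rest : ℕ
  row    = sum (λ j → f x (punchIn x j))
  column = sum (λ i → f (punchIn x i) x)
  rest   = sum (λ i → sum (λ j → f (punchIn x i) (punchIn x j)))

compCount-∖ : (R : Rel (suc n)) (x : Fin (suc n)) → compCount (R ∖ x) + compDegree R x ≤ compCount R
compCount-∖ R x = begin
  compCount (R ∖ x) + compDegree R x    ≡⟨ cong (_+ compDegree R x) compCount-R∖x ⟩
  rest + compDegree R x                 ≡⟨ +-comm rest (compDegree R x) ⟩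
  compDegree R x + rest                 ≤⟨ m≤n+m _ (comp R x x) ⟩
  comp R x x + (compDegree R x + rest)  ≡⟨ ∑∑-remove x (comp R) ⟨
  sum (λ i → sum (comp R i))            ≡⟨ compCount≡∑∑comp R ⟨
  compCount R                           ∎
  where
  open ≤-Reasoning
  rest : ℕ
  rest = sum (λ i → sum (λ j → comp R (punchIn x i) (punchIn x j)))
  compCount-R∖x : compCount (R ∖ x) ≡ rest
  compCount-R∖x = trans (compCount≡∑∑comp (R ∖ x)) (sum-cong-≗ λ i → sum-cong-≗ (comp-∖ R x i))

2^compDegree*2^compCount-∖≤2^compCount : (R : Rel (suc n)) (x : Fin (suc n)) →
                                        2 ^ compDegree R x * 2 ^ compCount (R ∖ x) ≤ 2 ^ compCount R
2^compDegree*2^compCount-∖≤2^compCount R x = begin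
  2 ^ compDegree R x * 2 ^ compCount (R ∖ x)  ≡⟨ ^-distribˡ-+-* 2 (compDegree R x) _ ⟨
  2 ^ (compDegree R x + compCount (R ∖ x))    ≡⟨ cong (2 ^_) (+-comm (compDegree R x) _) ⟩
  2 ^ (compCount (R ∖ x) + compDegree R x)    ≤⟨ ^-monoʳ-≤ 2 (compCount-∖ R x) ⟩
  2 ^ compCount R                             ∎
  where open ≤-Reasoning

≼⇒comp : (R : Rel n) {i j : Fin n} → i ≢ j → T (R i j) → 1 ≤ comp R i j + comp R j i
≼⇒comp R {i} {j} i≢j i≼j with <-cmp i j
... | tri< i<j _ _ = ≤-trans (≤-reflexive (sym (𝟙-yes (comparable? R i j) (i<j , T-∨ .from (inj₁ i≼j)))))
                             (m≤m+n _ _)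
  where open Equivalence
... | tri≈ _ i≡j _ = contradiction i≡j i≢j
... | tri> _ _ j<i = ≤-trans (≤-reflexive (sym (𝟙-yes (comparable? R j i) (j<i , T-∨ .from (inj₂ i≼j)))))
                             (m≤n+m _ _)
  where open Equivalence

upsetSize≤1+compDegree : (R : Rel (suc n)) (x : Fin (suc n)) → upsetSize R x ≤ 1 + compDegree R x
upsetSize≤1+compDegree R x = begin
  upsetSize R x
    ≡⟨ sum-remove {i = x} (λ j → 𝟙 (T? (R x j))) ⟩
  𝟙 (T? (R x x)) + sum (λ j → 𝟙 (T? (R x (punchIn x j))))
    ≤⟨ +-mono-≤ (𝟙≤1 (T? (R x x))) (sum-mono-≤ above) ⟩
  1 + compDegree R x
    ∎
  where
  open ≤-Reasoning
  above : ∀ j → 𝟙 (T? (R x (punchIn x j))) ≤ comp R x (punchIn x j) + comp R (punchIn x j) x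
  above j with T? (R x (punchIn x j))
  ... | yes x≼j = ≼⇒comp R (punchInᵢ≢i x j ∘ sym) x≼j
  ... | no _    = z≤n

1+n≤2^n : ∀ n → 1 + n ≤ 2 ^ n
1+n≤2^n zero    = ≤-refl
1+n≤2^n (suc n) = begin
  2 + n          ≤⟨ +-monoʳ-≤ 1 (1+n≤2^n n) ⟩
  1 + 2 ^ n      ≤⟨ +-monoˡ-≤ (2 ^ n) (m^n>0 2 n) ⟩
  2 ^ n + 2 ^ n  ≡⟨ cong (2 ^ n +_) (+-identityʳ (2 ^ n)) ⟨
  2 ^ suc n      ∎
  where open ≤-Reasoning

minimal-cover : {R : Rel (suc n)} → IsPartialOrderᵇ R →
                suc n ≤ sum (λ x → 𝟙 (minimal? R x) * 2 ^ compDegree R x)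
minimal-cover {n} {R} po = begin
  suc n                                ≡⟨ sum-const-1 (suc n) ⟨
  sum {suc n} (λ _ → 1)                ≤⟨ sum-mono-≤ covered ⟩
  sum (λ j → sum (λ x → χ x j))        ≡⟨ ∑-comm (λ j x → χ x j) ⟩
  sum (λ x → sum (λ j → χ x j))        ≡⟨ sum-cong-≗ (λ x → *-distribˡ-sum (μ x) (λ j → 𝟙 (T? (R x j)))) ⟨
  sum (λ x → μ x * upsetSize R x)      ≤⟨ sum-mono-≤ (λ x → *-monoʳ-≤ (μ x) (upsetSize≤2^compDegree x)) ⟩
  sum (λ x → μ x * 2 ^ compDegree R x) ∎
  where
  open ≤-Reasoning
  μ : Fin (suc n) → ℕ
  μ x = 𝟙 (minimal? R x)
  χ : Fin (suc n) → Fin (suc n) → ℕ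
  χ x j = μ x * 𝟙 (T? (R x j))
  covered : ∀ j → 1 ≤ sum (λ x → χ x j)
  covered j with x , x-minimal , x≼j ← minimal-below po j =
    ≤-trans (≤-reflexive (sym (cong₂ _*_ (𝟙-yes (minimal? R x) x-minimal) (𝟙-yes (T? (R x j)) x≼j))))
            (term≤sum x (λ y → χ y j))
  upsetSize≤2^compDegree : ∀ x → upsetSize R x ≤ 2 ^ compDegree R x
  upsetSize≤2^compDegree x = ≤-trans (upsetSize≤1+compDegree R x) (1+n≤2^n _)

-- Linear extensions starting with a minimal element

insertFirst : Fin (suc n) → Vec (Fin n) n → Vec (Fin (suc n)) (suc n)
insertFirst x σ = insertAt (Vec.map suc σ) x zero

insertFirst-lookup : (x : Fin (suc n)) (σ : Vec (Fin n) n) → lookup (insertFirst x σ) x ≡ zero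
insertFirst-lookup x σ = Vecₚ.insertAt-lookup (Vec.map suc σ) x zero

insertFirst-lookup-punchIn : (x : Fin (suc n)) (σ : Vec (Fin n) n) (i : Fin n) →
                             lookup (insertFirst x σ) (punchIn x i) ≡ suc (lookup σ i)
insertFirst-lookup-punchIn x σ i =
  trans (Vecₚ.insertAt-punchIn (Vec.map suc σ) x zero i) (Vecₚ.lookup-map i suc σ)

insertFirst-injective : (x : Fin (suc n)) → Injective _≡_ _≡_ (insertFirst x)
insertFirst-injective x {σ} {τ} σ≡τ = begin
  σ                        ≡⟨ Vecₚ.tabulate∘lookup σ ⟨
  Vec.tabulate (lookup σ)  ≡⟨ Vecₚ.tabulate-cong lookup-σ≡τ ⟩
  Vec.tabulate (lookup τ)  ≡⟨ Vecₚ.tabulate∘lookup τ ⟩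
  τ                        ∎
  where
  open ≡-Reasoning
  lookup-σ≡τ : ∀ i → lookup σ i ≡ lookup τ i
  lookup-σ≡τ i = Finₚ.suc-injective (begin
    suc (lookup σ i)                       ≡⟨ insertFirst-lookup-punchIn x σ i ⟨
    lookup (insertFirst x σ) (punchIn x i) ≡⟨ cong (λ υ → lookup υ (punchIn x i)) σ≡τ ⟩
    lookup (insertFirst x τ) (punchIn x i) ≡⟨ insertFirst-lookup-punchIn x τ i ⟩
    suc (lookup τ i)                       ∎)

data PunchInView (x : Fin (suc n)) : Fin (suc n) → Set where
  at-x       : PunchInView x x
  punched-in : ∀ i → PunchInView x (punchIn x i)

punchInView : (x j : Fin (suc n)) → PunchInView x j
punchInView x j with x ≟ j
... | yes refl = at-x
... | no x≢j   = subst (PunchInView x) (punchIn-punchOut x≢j) (punched-in (punchOut x≢j))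

insertFirst-isLinExt : {R : Rel (suc n)} {x : Fin (suc n)} {σ : Vec (Fin n) n} →
                       IsMinimal R x → IsLinExt (R ∖ x) σ → IsLinExt R (insertFirst x σ)
insertFirst-isLinExt {n} {R} {x} {σ} x-minimal (σ-injective , σ-monotone) = injective , monotone
  where
  τ : Vec (Fin (suc n)) (suc n)
  τ = insertFirst x σ
  τ-x : lookup τ x ≡ zero
  τ-x = insertFirst-lookup x σ
  τ-punchIn : ∀ i → lookup τ (punchIn x i) ≡ suc (lookup σ i)
  τ-punchIn = insertFirst-lookup-punchIn x σ
  injective : ∀ i j → lookup τ i ≡ lookup τ j → i ≡ j
  injective i j τi≡τj with punchInView x i | punchInView x j
  ... | at-x          | at-x          = refl
  ... | at-x          | punched-in j′ = contradiction (trans (sym τ-x) (trans τi≡τj (τ-punchIn j′))) (λ ())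
  ... | punched-in i′ | at-x          = contradiction (trans (sym (τ-punchIn i′)) (trans τi≡τj τ-x)) (λ ())
  ... | punched-in i′ | punched-in j′ = cong (punchIn x) (σ-injective i′ j′
          (Finₚ.suc-injective (trans (sym (τ-punchIn i′)) (trans τi≡τj (τ-punchIn j′)))))
  monotone : ∀ i j → T (R i j) → lookup τ i Fin.≤ lookup τ j
  monotone i j i≼j with punchInView x i | punchInView x j
  ... | at-x          | _             = subst (Fin._≤ lookup τ j) (sym τ-x) z≤n
  ... | punched-in i′ | at-x          = contradiction (x-minimal _ i≼j) (punchInᵢ≢i x i′)
  ... | punched-in i′ | punched-in j′ =
          subst₂ Fin._≤_ (sym (τ-punchIn i′)) (sym (τ-punchIn j′)) (s≤s (σ-monotone i′ j′ i≼j))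

IsLinExtStartingAt : Rel (suc n) → Fin (suc n) → Vec (Fin (suc n)) (suc n) → Set
IsLinExtStartingAt R x τ = IsLinExt R τ × lookup τ x ≡ zero

isLinExtStartingAt? : (R : Rel (suc n)) (x : Fin (suc n)) → Decidable (IsLinExtStartingAt R x)
isLinExtStartingAt? R x τ = isLinExt? R τ ×-dec (lookup τ x ≟ zero)

linExtCount-∖≤ : {R : Rel (suc n)} {x : Fin (suc n)} → IsMinimal R x →
                 linExtCount (R ∖ x) ≤ count (isLinExtStartingAt? R x) (allVecs (suc n) (suc n))
linExtCount-∖≤ {x = x} x-minimal = count-allVecs-≤ _ _ (insertFirst x) (insertFirst-injective x)
  (λ {σ} σ-ext → insertFirst-isLinExt x-minimal σ-ext , insertFirst-lookup x σ)

∑linExtCount-∖≤linExtCount : (R : Rel (suc n)) →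
                             sum (λ x → 𝟙 (minimal? R x) * linExtCount (R ∖ x)) ≤ linExtCount R
∑linExtCount-∖≤linExtCount {n} R = begin
  sum (λ x → 𝟙 (minimal? R x) * linExtCount (R ∖ x))     ≤⟨ sum-mono-≤ bound ⟩
  sum (λ x → count (isLinExtStartingAt? R x) perms)      ≤⟨ sum-count≤count (isLinExtStartingAt? R) (isLinExt? R)
                                                              (λ _ → proj₁) (λ {_ _ τ} → exclusive {τ = τ})
                                                              perms ⟩
  linExtCount R                                          ∎
  where
  open ≤-Reasoning
  perms : List (Vec (Fin (suc n)) (suc n))
  perms = allVecs (suc n) (suc n)
  bound : ∀ x → 𝟙 (minimal? R x) * linExtCount (R ∖ x) ≤ count (isLinExtStartingAt? R x) perms
  bound x with minimal? R x
  ... | yes x-minimal = ≤-trans (≤-reflexive (+-identityʳ _)) (linExtCount-∖≤ x-minimal)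
  ... | no _          = z≤n
  exclusive : ∀ {x y τ} → IsLinExtStartingAt R x τ → IsLinExtStartingAt R y τ → x ≡ y
  exclusive ((τ-injective , _) , τx≡0) (_ , τy≡0) = τ-injective _ _ (trans τx≡0 (sym τy≡0))

proposition5p4 : (n : ℕ) (R : Rel n) →
    IsPartialOrder (_≡_ {A = Fin n}) (λ i j → T (R i j)) →
    n ! ≤ linExtCount R * 2 ^ compCount R
-- For n = 0, linExtCount R computes to 1.
proposition5p4 zero    R _  = ≤-trans (m^n>0 2 (compCount R)) (≤-reflexive (sym (+-identityʳ _)))
proposition5p4 (suc n) R po = begin
  suc n * n !
    ≤⟨ *-monoˡ-≤ (n !) (minimal-cover po) ⟩
  sum (λ x → μ x * 2 ^ d x) * n !
    ≡⟨ *-distribʳ-sum (n !) (λ x → μ x * 2 ^ d x) ⟩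
  sum (λ x → μ x * 2 ^ d x * n !)
    ≤⟨ sum-mono-≤ (λ x → *-monoʳ-≤ (μ x * 2 ^ d x) (proposition5p4 n (R ∖ x) (∖-isPartialOrder x po))) ⟩
  sum (λ x → μ x * 2 ^ d x * (e x * 2 ^ c x))
    ≤⟨ sum-mono-≤ absorb ⟩
  sum (λ x → μ x * e x * 2 ^ compCount R)
    ≡⟨ *-distribʳ-sum (2 ^ compCount R) (λ x → μ x * e x) ⟨
  sum (λ x → μ x * e x) * 2 ^ compCount R
    ≤⟨ *-monoˡ-≤ (2 ^ compCount R) (∑linExtCount-∖≤linExtCount R) ⟩
  linExtCount R * 2 ^ compCount R
    ∎
  where
  open ≤-Reasoning
  μ d e c : Fin (suc n) → ℕ
  μ x = 𝟙 (minimal? R x)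
  d x = compDegree R x
  e x = linExtCount (R ∖ x)
  c x = compCount (R ∖ x)
  absorb : ∀ x → μ x * 2 ^ d x * (e x * 2 ^ c x) ≤ μ x * e x * 2 ^ compCount R
  absorb x = begin
    μ x * 2 ^ d x * (e x * 2 ^ c x)  ≡⟨ solve 4 (λ w x y z → w :* x :* (y :* z) := w :* y :* (x :* z))
                                               refl (μ x) (2 ^ d x) (e x) (2 ^ c x) ⟩
    μ x * e x * (2 ^ d x * 2 ^ c x)  ≤⟨ *-monoʳ-≤ (μ x * e x) (2^compDegree*2^compCount-∖≤2^compCount R x) ⟩
    μ x * e x * 2 ^ compCount R      ∎
    where open +-*-Solver
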